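{- Let $Q\in\mathbb F_q[T]$ be squarefree and monic, $h\ge0$ an integer, and let $(R_1,\dots,R_5)$ be a tuple of monic divisors of $Q$ such that: (i) $|R_i|\ge q^h$ for all $i$; (ii) no three of the $R_i$ are equal; (iii) for any $i\ne j$, either $R_i=R_j$, or both $\left|\frac{R_i}{\gcd(R_i,R_j)}\right|\ge q^h$ and $|\gcd(R_i,R_j)|<q^{h/2}$; (iv) $R_1,R_2,R_3$ are pairwise distinct. Then $\left|\frac{R_2}{\gcd(R_1,R_2)}\right|\ge q^h$ and $\left|\frac{R_3}{\gcd(R_3,R_1R_2)}\right|\ge q^{h/2}$.
   Context: $\mathbb F_q$ is a finite field; for nonzero $F\in\mathbb F_q[T]$, $|F|=q^{\deg F}$; gcds are taken monic. -}

module Defs where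

open import Level using (Level; _⊔_) renaming (suc to lsuc)
open import Data.Nat as ℕ using (ℕ; zero; suc; _^_)
open import Data.Fin using (Fin)
open import Data.List using (List; []; _∷_; length)
open import Data.Product using (Σ; ∃; _×_; _,_)
open import Relation.Nullary using (¬_; yes; no)
open import Relation.Binary using (Decidable)
open import Relation.Binary.PropositionalEquality using (_≡_)
open import Algebra.Bundles using (CommutativeRing)

record FiniteField (c ℓ : Level) : Set (lsuc (c ⊔ ℓ)) where
  field
    commRing : CommutativeRing c ℓ
  open CommutativeRing commRing public
  field
    _≟_      : Decidable _≈_
    0≉1      : ¬ (0# ≈ 1#)
    inverse  : ∀ x → ¬ (x ≈ 0#) → Σ Carrier λ y → (x * y) ≈ 1#
    q        : ℕ
    enum     : Fin q → Carrier
    enum-inj : ∀ i j → enum i ≈ enum j → i ≡ j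
    enum-sur : ∀ x → Σ (Fin q) λ i → enum i ≈ x

-- Polynomials in F_q[T] as coefficient lists, lowest degree first.
module Poly {c ℓ : Level} (F : FiniteField c ℓ) where
  open FiniteField F renaming (q to q₀)

  q : ℕ
  q = q₀

  Pol : Set c
  Pol = List Carrier

  coeff : Pol → ℕ → Carrier
  coeff []      _       = 0#
  coeff (a ∷ _) zero    = a
  coeff (_ ∷ p) (suc n) = coeff p n

  _≈ₚ_ : Pol → Pol → Set ℓ
  p ≈ₚ r = ∀ n → coeff p n ≈ coeff r n

  _+ₚ_ : Pol → Pol → Pol
  []      +ₚ r       = r
  (a ∷ p) +ₚ []      = a ∷ p
  (a ∷ p) +ₚ (b ∷ r) = (a + b) ∷ (p +ₚ r)

  scale : Carrier → Pol → Pol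
  scale a []      = []
  scale a (b ∷ p) = (a * b) ∷ scale a p

  _*ₚ_ : Pol → Pol → Pol
  []      *ₚ r = []
  (a ∷ p) *ₚ r = scale a r +ₚ (0# ∷ (p *ₚ r))

  -- remove trailing zero coefficients (normal form)
  strip : Pol → Pol
  strip [] = []
  strip (a ∷ p) with strip p
  ... | b ∷ p' = a ∷ b ∷ p'
  ... | [] with a ≟ 0#
  ...   | yes _ = []
  ...   | no  _ = a ∷ []

  lastC : Pol → Carrier
  lastC []          = 0#
  lastC (a ∷ [])    = a
  lastC (_ ∷ b ∷ p) = lastC (b ∷ p)

  -- leading coefficient (0 for the zero polynomial)
  lead : Pol → Carrier
  lead p = lastC (strip p)

  Monic : Pol → Set ℓ
  Monic p = lead p ≈ 1#

  -- degree of a nonzero polynomial (deg 0 := 0, only used via ∣_∣ₚ)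
  deg : Pol → ℕ
  deg p with strip p
  ... | []     = 0
  ... | _ ∷ xs = length xs

  -- |P| = q^deg P for P ≠ 0, and |0| = 0
  ∣_∣ₚ : Pol → ℕ
  ∣ p ∣ₚ with strip p
  ... | []     = 0
  ... | _ ∷ xs = q ^ length xs

  _∣ₚ_ : Pol → Pol → Set (c ⊔ ℓ)
  a ∣ₚ b = Σ Pol λ d → (a *ₚ d) ≈ₚ b

  IsGCD : Pol → Pol → Pol → Set (c ⊔ ℓ)
  IsGCD g a b = Monic g × g ∣ₚ a × g ∣ₚ b
              × (∀ d → d ∣ₚ a → d ∣ₚ b → d ∣ₚ g)

  Squarefree : Pol → Set (c ⊔ ℓ)
  Squarefree p = ∀ d → 1 ℕ.≤ deg d → ¬ ((d *ₚ d) ∣ₚ p)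

-- Write A, B, C for R₁, R₂, R₃ and g = gcd(C, AB), g₁ = gcd(C, A), g₂ = gcd(C, B).
-- Multiplying the Bézout identities of g₁ and g₂ exhibits g₁g₂ as a combination of C and AB,
-- so g ∣ g₁g₂.  Comparing degrees in C = g·(C/g) = g₁·(C/g₁) then gives |C/g₁| ≤ |g₂|·|C/g|,
-- and since |C/g₁| ≥ q^h while |g₂|² < q^h, we get |C/g|² ≥ q^h.  The first claim is (iii)
-- for the pair (R₂, R₁).
module Submission where

open import Defs
open import Level using (Level; _⊔_)

module PolynomialGcd {c ℓ : Level} (F : FiniteField c ℓ) where
  open import Data.Nat as ℕ using (ℕ; zero; suc; z≤n; s≤s; _^_)
  import Data.Nat.Properties as ℕₚ
  open import Data.Fin.Properties using (nonZeroIndex)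
  open import Data.List using ([]; _∷_; length)
  open import Data.Product using (Σ; _×_; _,_; proj₁; proj₂)
  open import Data.Sum using (_⊎_; inj₁; inj₂)
  open import Data.Empty using (⊥-elim)
  open import Relation.Nullary using (¬_; yes; no)
  open import Relation.Binary.Bundles using (Setoid)
  open import Relation.Binary.Definitions using (tri<; tri≈; tri>)
  open import Relation.Binary.PropositionalEquality as ≡ using (_≡_)
  import Relation.Binary.Reasoning.Setoid as SetoidReasoning
  open import Algebra.Bundles using (CommutativeRing)
  import Algebra.Properties.Ring as RingProperties
  import Algebra.Properties.CommutativeSemigroup as CommutativeSemigroupProperties
  import Algebra.Solver.Ring.NaturalCoefficients.Default as NaturalCoefficientsSolver

  open FiniteField F hiding (q; zero)
  open Poly F
  open RingProperties ring using (-1*x≈-x; -‿distribˡ-*)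
  open NaturalCoefficientsSolver commutativeSemiring
    using (solve; _:+_; _:=_)
  open CommutativeSemigroupProperties ℕₚ.+-commutativeSemigroup using () renaming (interchange to +-interchange)
  open CommutativeSemigroupProperties ℕₚ.*-commutativeSemigroup using () renaming (interchange to *-interchange)

  -- Polynomials form a commutative ring

  -- The record wrapper makes both polynomials inferable from an equality proof.
  record _≋_ (p r : Pol) : Set ℓ where
    constructor pointwise
    field coeff-≈ : p ≈ₚ r
  open _≋_ public
  infix 4 _≋_

  ≋-refl : ∀ {p} → p ≋ p
  ≋-refl = pointwise λ _ → refl

  ≋-sym : ∀ {p r} → p ≋ r → r ≋ p
  ≋-sym (pointwise e) = pointwise λ n → sym (e n)

  ≋-trans : ∀ {p r s} → p ≋ r → r ≋ s → p ≋ s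
  ≋-trans (pointwise e) (pointwise f) = pointwise λ n → trans (e n) (f n)

  ≋-setoid : Setoid c ℓ
  ≋-setoid = record
    { Carrier = Pol ; _≈_ = _≋_
    ; isEquivalence = record { refl = ≋-refl ; sym = ≋-sym ; trans = ≋-trans } }

  shift : Pol → Pol
  shift p = 0# ∷ p

  ∷-cong : ∀ {x y p r} → x ≈ y → p ≋ r → (x ∷ p) ≋ (y ∷ r)
  ∷-cong x≈y (pointwise p≈r) = pointwise λ { zero → x≈y ; (suc n) → p≈r n }

  shift-[] : shift [] ≋ []
  shift-[] = pointwise λ { zero → refl ; (suc n) → refl }

  shift-cong-[] : ∀ {p} → p ≋ [] → shift p ≋ []
  shift-cong-[] p≈0 = ≋-trans (∷-cong refl p≈0) shift-[]

  coeff-+ₚ : ∀ p r n → coeff (p +ₚ r) n ≈ coeff p n + coeff r n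
  coeff-+ₚ []      r       n       = sym (+-identityˡ _)
  coeff-+ₚ (a ∷ p) []      n       = sym (+-identityʳ _)
  coeff-+ₚ (a ∷ p) (b ∷ r) zero    = refl
  coeff-+ₚ (a ∷ p) (b ∷ r) (suc n) = coeff-+ₚ p r n

  coeff-scale : ∀ a p n → coeff (scale a p) n ≈ a * coeff p n
  coeff-scale a []      n       = sym (zeroʳ a)
  coeff-scale a (b ∷ p) zero    = refl
  coeff-scale a (b ∷ p) (suc n) = coeff-scale a p n

  coeff-*ₚ : ∀ x p r n → coeff ((x ∷ p) *ₚ r) n ≈ x * coeff r n + coeff (shift (p *ₚ r)) n
  coeff-*ₚ x p r n = trans (coeff-+ₚ (scale x r) (shift (p *ₚ r)) n) (+-cong (coeff-scale x r n) refl)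

  +ₚ-cong : ∀ {p p' r r'} → p ≋ p' → r ≋ r' → (p +ₚ r) ≋ (p' +ₚ r')
  +ₚ-cong {p} {p'} {r} {r'} (pointwise e) (pointwise f) = pointwise λ n →
    trans (coeff-+ₚ p r n) (trans (+-cong (e n) (f n)) (sym (coeff-+ₚ p' r' n)))

  +ₚ-comm : ∀ p r → (p +ₚ r) ≋ (r +ₚ p)
  +ₚ-comm p r = pointwise λ n →
    trans (coeff-+ₚ p r n) (trans (+-comm _ _) (sym (coeff-+ₚ r p n)))

  +ₚ-assoc : ∀ p r s → ((p +ₚ r) +ₚ s) ≋ (p +ₚ (r +ₚ s))
  +ₚ-assoc p r s = pointwise λ n → begin
      coeff ((p +ₚ r) +ₚ s) n
    ≈⟨ trans (coeff-+ₚ (p +ₚ r) s n) (+-cong (coeff-+ₚ p r n) refl) ⟩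
      (coeff p n + coeff r n) + coeff s n
    ≈⟨ +-assoc _ _ _ ⟩
      coeff p n + (coeff r n + coeff s n)
    ≈⟨ sym (trans (coeff-+ₚ p (r +ₚ s) n) (+-cong refl (coeff-+ₚ r s n))) ⟩
      coeff (p +ₚ (r +ₚ s)) n ∎
    where open SetoidReasoning setoid

  +ₚ-identityʳ : ∀ p → (p +ₚ []) ≋ p
  +ₚ-identityʳ p = pointwise λ n → trans (coeff-+ₚ p [] n) (+-identityʳ _)

  +ₚ-interchange : ∀ a b c d → ((a +ₚ b) +ₚ (c +ₚ d)) ≋ ((a +ₚ c) +ₚ (b +ₚ d))
  +ₚ-interchange a b c d = pointwise λ n → begin
      coeff ((a +ₚ b) +ₚ (c +ₚ d)) n
    ≈⟨ trans (coeff-+ₚ (a +ₚ b) (c +ₚ d) n) (+-cong (coeff-+ₚ a b n) (coeff-+ₚ c d n)) ⟩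
      (coeff a n + coeff b n) + (coeff c n + coeff d n)
    ≈⟨ solve 4 (λ a b c d → (a :+ b) :+ (c :+ d) := (a :+ c) :+ (b :+ d)) refl _ _ _ _ ⟩
      (coeff a n + coeff c n) + (coeff b n + coeff d n)
    ≈⟨ sym (trans (coeff-+ₚ (a +ₚ c) (b +ₚ d) n) (+-cong (coeff-+ₚ a c n) (coeff-+ₚ b d n))) ⟩
      coeff ((a +ₚ c) +ₚ (b +ₚ d)) n ∎
    where open SetoidReasoning setoid

  +ₚ-swapˡ : ∀ a b c → (a +ₚ (b +ₚ c)) ≋ (b +ₚ (a +ₚ c))
  +ₚ-swapˡ a b c = pointwise λ n → begin
      coeff (a +ₚ (b +ₚ c)) n
    ≈⟨ trans (coeff-+ₚ a (b +ₚ c) n) (+-cong refl (coeff-+ₚ b c n)) ⟩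
      coeff a n + (coeff b n + coeff c n)
    ≈⟨ solve 3 (λ a b c → a :+ (b :+ c) := b :+ (a :+ c)) refl _ _ _ ⟩
      coeff b n + (coeff a n + coeff c n)
    ≈⟨ sym (trans (coeff-+ₚ b (a +ₚ c) n) (+-cong refl (coeff-+ₚ a c n))) ⟩
      coeff (b +ₚ (a +ₚ c)) n ∎
    where open SetoidReasoning setoid

  negₚ : Pol → Pol
  negₚ p = scale (- 1#) p

  +ₚ-inverseʳ : ∀ p → (p +ₚ negₚ p) ≋ []
  +ₚ-inverseʳ p = pointwise λ n →
    trans (coeff-+ₚ p (negₚ p) n)
      (trans (+-cong refl (trans (coeff-scale (- 1#) p n) (-1*x≈-x (coeff p n)))) (-‿inverseʳ _))

  scale-cong : ∀ {a b p r} → a ≈ b → p ≋ r → scale a p ≋ scale b r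
  scale-cong {a} {b} {p} {r} a≈b (pointwise p≈r) = pointwise λ n →
    trans (coeff-scale a p n) (trans (*-cong a≈b (p≈r n)) (sym (coeff-scale b r n)))

  scale-≈0 : ∀ {a} r → a ≈ 0# → scale a r ≋ []
  scale-≈0 {a} r a≈0 = pointwise λ n →
    trans (coeff-scale a r n) (trans (*-cong a≈0 refl) (zeroˡ _))

  scale-distribˡ : ∀ a p r → scale a (p +ₚ r) ≋ (scale a p +ₚ scale a r)
  scale-distribˡ a p r = pointwise λ n →
    trans (coeff-scale a (p +ₚ r) n) (trans (*-cong refl (coeff-+ₚ p r n))
      (trans (distribˡ _ _ _)
        (sym (trans (coeff-+ₚ (scale a p) (scale a r) n) (+-cong (coeff-scale a p n) (coeff-scale a r n))))))

  scale-distribʳ : ∀ a b p → scale (a + b) p ≋ (scale a p +ₚ scale b p)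
  scale-distribʳ a b p = pointwise λ n →
    trans (coeff-scale (a + b) p n) (trans (distribʳ _ _ _)
      (sym (trans (coeff-+ₚ (scale a p) (scale b p) n) (+-cong (coeff-scale a p n) (coeff-scale b p n)))))

  scale-assoc : ∀ a b p → scale (a * b) p ≋ scale a (scale b p)
  scale-assoc a b p = pointwise λ n →
    trans (coeff-scale (a * b) p n) (trans (*-assoc _ _ _)
      (sym (trans (coeff-scale a (scale b p) n) (*-cong refl (coeff-scale b p n)))))

  *ₚ-zeroˡ : ∀ {p} r → p ≋ [] → (p *ₚ r) ≋ []
  *ₚ-zeroˡ {[]}    r p≈0             = ≋-refl
  *ₚ-zeroˡ {x ∷ p} r (pointwise p≈0) =
    +ₚ-cong (scale-≈0 r (p≈0 0)) (shift-cong-[] (*ₚ-zeroˡ {p} r (pointwise λ n → p≈0 (suc n))))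

  *ₚ-zeroʳ : ∀ r → (r *ₚ []) ≋ []
  *ₚ-zeroʳ []      = ≋-refl
  *ₚ-zeroʳ (y ∷ r) = shift-cong-[] (*ₚ-zeroʳ r)

  *ₚ-congˡ : ∀ {p p'} r → p ≋ p' → (p *ₚ r) ≋ (p' *ₚ r)
  *ₚ-congˡ {[]}    {p'}     r p≈p' = ≋-sym (*ₚ-zeroˡ r (≋-sym p≈p'))
  *ₚ-congˡ {x ∷ p} {[]}     r p≈p' = *ₚ-zeroˡ r p≈p'
  *ₚ-congˡ {x ∷ p} {y ∷ p'} r (pointwise e) =
    +ₚ-cong (scale-cong (e 0) ≋-refl) (∷-cong refl (*ₚ-congˡ {p} {p'} r (pointwise λ n → e (suc n))))

  *ₚ-congʳ : ∀ p {r r'} → r ≋ r' → (p *ₚ r) ≋ (p *ₚ r')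
  *ₚ-congʳ []      r≈r' = ≋-refl
  *ₚ-congʳ (x ∷ p) r≈r' = +ₚ-cong (scale-cong refl r≈r') (∷-cong refl (*ₚ-congʳ p r≈r'))

  *ₚ-cong : ∀ {p p' r r'} → p ≋ p' → r ≋ r' → (p *ₚ r) ≋ (p' *ₚ r')
  *ₚ-cong {p} {p'} {r} p≈p' r≈r' = ≋-trans (*ₚ-congˡ r p≈p') (*ₚ-congʳ p' r≈r')

  *ₚ-distribʳ : ∀ p p' r → ((p +ₚ p') *ₚ r) ≋ ((p *ₚ r) +ₚ (p' *ₚ r))
  *ₚ-distribʳ []      p'       r = ≋-refl
  *ₚ-distribʳ (x ∷ p) []       r = ≋-sym (+ₚ-identityʳ _)
  *ₚ-distribʳ (x ∷ p) (y ∷ p') r = ≋-trans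
    (+ₚ-cong (scale-distribʳ x y r) (∷-cong (sym (+-identityˡ 0#)) (*ₚ-distribʳ p p' r)))
    (+ₚ-interchange (scale x r) (scale y r) (shift (p *ₚ r)) (shift (p' *ₚ r)))

  scale-*ₚ : ∀ x r s → (scale x r *ₚ s) ≋ scale x (r *ₚ s)
  scale-*ₚ x []      s = ≋-refl
  scale-*ₚ x (y ∷ r) s = ≋-trans
    (+ₚ-cong (scale-assoc x y s) (∷-cong (sym (zeroʳ x)) (scale-*ₚ x r s)))
    (≋-sym (scale-distribˡ x (scale y s) (shift (r *ₚ s))))

  *ₚ-assoc : ∀ p r s → ((p *ₚ r) *ₚ s) ≋ (p *ₚ (r *ₚ s))
  *ₚ-assoc []      r s = ≋-refl
  *ₚ-assoc (x ∷ p) r s = ≋-trans (*ₚ-distribʳ (scale x r) (shift (p *ₚ r)) s)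
    (+ₚ-cong (scale-*ₚ x r s)
      (≋-trans (+ₚ-cong {r = shift ((p *ₚ r) *ₚ s)} (scale-≈0 s refl) ≋-refl)
        (∷-cong refl (*ₚ-assoc p r s))))

  *ₚ-∷ʳ : ∀ r x p → (r *ₚ (x ∷ p)) ≋ (scale x r +ₚ shift (r *ₚ p))
  *ₚ-∷ʳ []      x p = ≋-sym shift-[]
  *ₚ-∷ʳ (y ∷ r) x p = ∷-cong (+-cong (*-comm y x) refl) (≋-trans
    (+ₚ-cong {scale y p} ≋-refl (*ₚ-∷ʳ r x p)) (+ₚ-swapˡ (scale y p) (scale x r) (shift (r *ₚ p))))

  *ₚ-comm : ∀ p r → (p *ₚ r) ≋ (r *ₚ p)
  *ₚ-comm []      r = ≋-sym (*ₚ-zeroʳ r)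
  *ₚ-comm (x ∷ p) r =
    ≋-trans (+ₚ-cong {scale x r} ≋-refl (∷-cong refl (*ₚ-comm p r))) (≋-sym (*ₚ-∷ʳ r x p))

  oneₚ : Pol
  oneₚ = 1# ∷ []

  *ₚ-identityˡ : ∀ p → (oneₚ *ₚ p) ≋ p
  *ₚ-identityˡ p = pointwise λ n →
    trans (coeff-+ₚ (scale 1# p) (shift []) n)
      (trans (+-cong (coeff-scale 1# p n) (coeff-≈ shift-[] n)) (trans (+-identityʳ _) (*-identityˡ _)))

  polyCommutativeRing : CommutativeRing c ℓ
  polyCommutativeRing = record
    { Carrier = Pol ; _≈_ = _≋_ ; _+_ = _+ₚ_ ; _*_ = _*ₚ_ ; -_ = negₚ ; 0# = [] ; 1# = oneₚ
    ; isCommutativeRing = record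
      { isRing = record
        { +-isAbelianGroup = record
          { isGroup = record
            { isMonoid = record
              { isSemigroup = record
                { isMagma = record { isEquivalence = Setoid.isEquivalence ≋-setoid ; ∙-cong = +ₚ-cong }
                ; assoc = +ₚ-assoc }
              ; identity = (λ p → ≋-refl) , +ₚ-identityʳ }
            ; inverse = (λ p → ≋-trans (+ₚ-comm (negₚ p) p) (+ₚ-inverseʳ p)) , +ₚ-inverseʳ
            ; ⁻¹-cong = scale-cong refl }
          ; comm = +ₚ-comm }
        ; *-cong = *ₚ-cong
        ; *-assoc = *ₚ-assoc
        ; *-identity = *ₚ-identityˡ , (λ p → ≋-trans (*ₚ-comm p oneₚ) (*ₚ-identityˡ p))
        ; distrib = (λ x y z → ≋-trans (*ₚ-comm x (y +ₚ z))
                       (≋-trans (*ₚ-distribʳ y z x) (+ₚ-cong (*ₚ-comm y x) (*ₚ-comm z x))))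
                  , (λ x y z → *ₚ-distribʳ y z x) }
      ; *-comm = *ₚ-comm } }

  module PolySolver = NaturalCoefficientsSolver (CommutativeRing.commutativeSemiring polyCommutativeRing)
  open PolySolver using () renaming (solve to solveₚ; _:+_ to _⊕_; _:*_ to _⊛_; _:=_ to _⊜_)

  -- Degrees

  record DegBelow (p : Pol) (n : ℕ) : Set ℓ where
    constructor degBelow
    field vanishes : ∀ k → n ℕ.≤ k → coeff p k ≈ 0#
  open DegBelow public

  record HasDeg (p : Pol) (m : ℕ) : Set ℓ where
    constructor hasDeg
    field
      top≉0 : ¬ (coeff p m ≈ 0#)
      below : DegBelow p (suc m)
  open HasDeg public

  DegBelow-resp : ∀ {p r n} → p ≋ r → DegBelow p n → DegBelow r n
  DegBelow-resp (pointwise e) (degBelow v) = degBelow λ k n≤k → trans (sym (e k)) (v k n≤k)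

  HasDeg-resp : ∀ {p r m} → p ≋ r → HasDeg p m → HasDeg r m
  HasDeg-resp (pointwise e) (hasDeg top b) =
    hasDeg (λ top≈0 → top (trans (e _) top≈0)) (DegBelow-resp (pointwise e) b)

  DegBelow-mono : ∀ {p n n'} → n ℕ.≤ n' → DegBelow p n → DegBelow p n'
  DegBelow-mono n≤n' (degBelow v) = degBelow λ k n'≤k → v k (ℕₚ.≤-trans n≤n' n'≤k)

  HasDeg⇒≉[] : ∀ {p m} → HasDeg p m → ¬ (p ≋ [])
  HasDeg⇒≉[] d (pointwise p≈0) = top≉0 d (p≈0 _)

  HasDeg-unique : ∀ {p m m'} → HasDeg p m → HasDeg p m' → m ≡ m'
  HasDeg-unique {m = m} {m'} (hasDeg top b) (hasDeg top' b') with ℕₚ.<-cmp m m'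
  ... | tri< m<m' _ _ = ⊥-elim (top' (vanishes b m' m<m'))
  ... | tri≈ _ m≡m' _ = m≡m'
  ... | tri> _ _ m>m' = ⊥-elim (top (vanishes b' m m>m'))

  DegBelow-length : ∀ p → DegBelow p (length p)
  DegBelow-length p = degBelow (vanish p)
    where
      vanish : ∀ p k → length p ℕ.≤ k → coeff p k ≈ 0#
      vanish []      k       _         = refl
      vanish (x ∷ p) (suc k) (s≤s le) = vanish p k le

  coeff-length : ∀ x xs → coeff (x ∷ xs) (length xs) ≡ lastC (x ∷ xs)
  coeff-length x []       = ≡.refl
  coeff-length x (y ∷ ys) = coeff-length y ys

  *-≉0 : ∀ {x y} → ¬ (x ≈ 0#) → ¬ (y ≈ 0#) → ¬ (x * y ≈ 0#)
  *-≉0 {x} {y} x≉0 y≉0 xy≈0 with inverse x x≉0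
  ... | x⁻¹ , xx⁻¹≈1 = y≉0 (begin
      y                ≈⟨ sym (*-identityˡ y) ⟩
      1# * y           ≈⟨ *-cong (sym (trans (*-comm x⁻¹ x) xx⁻¹≈1)) refl ⟩
      (x⁻¹ * x) * y    ≈⟨ *-assoc x⁻¹ x y ⟩
      x⁻¹ * (x * y)    ≈⟨ *-cong refl xy≈0 ⟩
      x⁻¹ * 0#         ≈⟨ zeroʳ x⁻¹ ⟩
      0#               ∎)
    where open SetoidReasoning setoid

  DegBelow-*ₚ : ∀ p r M N → DegBelow p (suc M) → DegBelow r (suc N)
              → DegBelow (p *ₚ r) (suc (M ℕ.+ N)) × (coeff (p *ₚ r) (M ℕ.+ N) ≈ coeff p M * coeff r N)
  DegBelow-*ₚ []      r M       N _            _            = degBelow (λ _ _ → refl) , sym (zeroˡ _)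
  DegBelow-*ₚ (x ∷ p) r zero    N (degBelow vp) (degBelow vr) = degBelow vanish , top
    where
      tail≈0 : ∀ k → coeff (shift (p *ₚ r)) k ≈ 0#
      tail≈0 = coeff-≈ (shift-cong-[] (*ₚ-zeroˡ {p} r (pointwise λ k → vp (suc k) (s≤s z≤n))))
      vanish : ∀ k → suc N ℕ.≤ k → coeff ((x ∷ p) *ₚ r) k ≈ 0#
      vanish k le = trans (coeff-*ₚ x p r k)
        (trans (+-cong (*-cong refl (vr k le)) (tail≈0 k)) (trans (+-identityʳ _) (zeroʳ x)))
      top : coeff ((x ∷ p) *ₚ r) N ≈ x * coeff r N
      top = trans (coeff-*ₚ x p r N) (trans (+-cong refl (tail≈0 N)) (+-identityʳ _))
  DegBelow-*ₚ (x ∷ p) r (suc M) N (degBelow vp) (degBelow vr) = degBelow vanish , top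
    where
      ih = DegBelow-*ₚ p r M N (degBelow λ k le → vp (suc k) (s≤s le)) (degBelow vr)
      vanish : ∀ k → suc (suc (M ℕ.+ N)) ℕ.≤ k → coeff ((x ∷ p) *ₚ r) k ≈ 0#
      vanish (suc k) (s≤s le) = trans (coeff-*ₚ x p r (suc k))
        (trans (+-cong (*-cong refl (vr (suc k) (s≤s (ℕₚ.≤-trans (ℕₚ.m≤n+m N M) (ℕₚ.≤-trans (ℕₚ.n≤1+n _) le)))))
                       (vanishes (proj₁ ih) k le))
          (trans (+-identityʳ _) (zeroʳ x)))
      top : coeff ((x ∷ p) *ₚ r) (suc (M ℕ.+ N)) ≈ coeff p M * coeff r N
      top = trans (coeff-*ₚ x p r (suc (M ℕ.+ N)))
        (trans (+-cong (*-cong refl (vr (suc (M ℕ.+ N)) (s≤s (ℕₚ.m≤n+m N M)))) (proj₂ ih))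
          (trans (+-cong (zeroʳ x) refl) (+-identityˡ _)))

  HasDeg-*ₚ : ∀ {a b m n} → HasDeg a m → HasDeg b n → HasDeg (a *ₚ b) (m ℕ.+ n)
  HasDeg-*ₚ {a} {b} {m} {n} (hasDeg topa ba) (hasDeg topb bb) with DegBelow-*ₚ a b m n ba bb
  ... | b-ab , top-ab = hasDeg (λ top≈0 → *-≉0 topa topb (trans (sym top-ab) top≈0)) b-ab

  strip-coeff : ∀ p n → coeff (strip p) n ≈ coeff p n
  strip-coeff []      n       = refl
  strip-coeff (a ∷ p) zero    with strip p | strip-coeff p
  ... | b ∷ p' | _ = refl
  ... | []     | _ with a ≟ 0#
  ...   | yes a≈0 = sym a≈0
  ...   | no  _   = refl
  strip-coeff (a ∷ p) (suc n) with strip p | strip-coeff p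
  ... | b ∷ p' | ih = ih n
  ... | []     | ih with a ≟ 0#
  ...   | yes _ = ih n
  ...   | no  _ = ih n

  strip-shape : ∀ p → strip p ≡ [] ⊎ Σ Carrier λ x → Σ Pol λ xs → strip p ≡ x ∷ xs × ¬ (lastC (x ∷ xs) ≈ 0#)
  strip-shape []      = inj₁ ≡.refl
  strip-shape (a ∷ p) with strip p | strip-shape p
  ... | b ∷ p' | inj₂ (_ , _ , ≡.refl , last≉0) = inj₂ (a , b ∷ p' , ≡.refl , last≉0)
  ... | []     | _ with a ≟ 0#
  ...   | yes _   = inj₁ ≡.refl
  ...   | no  a≉0 = inj₂ (a , [] , ≡.refl , a≉0)

  -- The one place where the strip-based lead and ∣_∣ₚ are unfolded.
  ≋[]⊎HasDeg : ∀ p → (p ≋ [] × lead p ≡ 0#)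
                   ⊎ Σ ℕ λ m → HasDeg p m × ∣ p ∣ₚ ≡ q ^ m × lead p ≈ coeff p m
  ≋[]⊎HasDeg p with strip p | strip-coeff p | strip-shape p
  ... | _ | sc | inj₁ ≡.refl = inj₁ (pointwise (λ n → sym (sc n)) , ≡.refl)
  ... | _ | sc | inj₂ (x , xs , ≡.refl , last≉0) =
    inj₂ (length xs , hasDeg (λ top≈0 → last≉0 (trans lead≈top top≈0)) vanish , ≡.refl , lead≈top)
    where
      lead≈top : lastC (x ∷ xs) ≈ coeff p (length xs)
      lead≈top = ≡.subst (_≈ coeff p (length xs)) (coeff-length x xs) (sc (length xs))
      vanish : DegBelow p (suc (length xs))
      vanish = degBelow λ k le → trans (sym (sc k)) (vanishes (DegBelow-length (x ∷ xs)) k le)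

  ∣∣ₚ-HasDeg : ∀ {p m} → HasDeg p m → ∣ p ∣ₚ ≡ q ^ m
  ∣∣ₚ-HasDeg {p} d with ≋[]⊎HasDeg p
  ... | inj₁ (p≈0 , _)               = ⊥-elim (HasDeg⇒≉[] d p≈0)
  ... | inj₂ (m' , d' , ∣p∣≡q^m' , _) = ≡.trans ∣p∣≡q^m' (≡.cong (q ^_) (HasDeg-unique d' d))

  lead-HasDeg : ∀ {p m} → HasDeg p m → lead p ≈ coeff p m
  lead-HasDeg {p} d with ≋[]⊎HasDeg p
  ... | inj₁ (p≈0 , _)          = ⊥-elim (HasDeg⇒≉[] d p≈0)
  ... | inj₂ (m' , d' , _ , lead≈) = ≡.subst (λ k → lead p ≈ coeff p k) (HasDeg-unique d' d) lead≈

  Monic⇒HasDeg : ∀ p → Monic p → Σ ℕ (HasDeg p)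
  Monic⇒HasDeg p monic with ≋[]⊎HasDeg p
  ... | inj₁ (_ , lead≡0)    = ⊥-elim (0≉1 (≡.subst (_≈ 1#) lead≡0 monic))
  ... | inj₂ (m , d , _ , _) = m , d

  HasDeg-factorʳ : ∀ {p m} x y → HasDeg p m → (x *ₚ y) ≋ p → Σ ℕ (HasDeg y)
  HasDeg-factorʳ x y d xy≈p with ≋[]⊎HasDeg y
  ... | inj₁ (y≈0 , _)        = ⊥-elim (HasDeg⇒≉[] d (≋-trans (≋-sym xy≈p) (≋-trans (*ₚ-congʳ x y≈0) (*ₚ-zeroʳ x))))
  ... | inj₂ (n , dy , _ , _) = n , dy

  HasDeg⇒< : ∀ {p m n} → HasDeg p m → DegBelow p n → m ℕ.< n
  HasDeg⇒< {m = m} {n} d b with m ℕₚ.<? n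
  ... | yes m<n = m<n
  ... | no  m≮n = ⊥-elim (top≉0 d (vanishes b m (ℕₚ.≮⇒≥ m≮n)))

  -- Division with remainder

  divMod : ∀ {b m} → HasDeg b m → ∀ a → Σ Pol λ quot → Σ Pol λ rem → a ≋ ((quot *ₚ b) +ₚ rem) × DegBelow rem m
  divMod {b} {m} db [] = [] , [] , ≋-refl , degBelow (λ _ _ → refl)
  divMod {b} {m} db (a₀ ∷ a) with divMod db a
  ... | quot , rem , pointwise a≈ , degBelow rem-vanish =
    (k ∷ quot) , (s +ₚ scale (- k) b) , pointwise a₀∷a≈ , degBelow vanish
    where
      s = a₀ ∷ rem
      -- k kills the coefficient of T^m in s.
      k = coeff s m * proj₁ (inverse (coeff b m) (top≉0 db))
      k*top≈ : k * coeff b m ≈ coeff s m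
      k*top≈ = trans (*-assoc _ _ _)
        (trans (*-cong refl (trans (*-comm _ _) (proj₂ (inverse (coeff b m) (top≉0 db))))) (*-identityʳ _))
      coeff-rem : ∀ n → coeff (s +ₚ scale (- k) b) n ≈ coeff s n + - (k * coeff b n)
      coeff-rem n = trans (coeff-+ₚ s (scale (- k) b) n)
        (+-cong refl (trans (coeff-scale (- k) b n) (sym (-‿distribˡ-* k (coeff b n)))))
      coeff-sum : ∀ n → coeff (((k ∷ quot) *ₚ b) +ₚ (s +ₚ scale (- k) b)) n
                      ≈ coeff (shift (quot *ₚ b)) n + coeff s n
      coeff-sum n = begin
          coeff (((k ∷ quot) *ₚ b) +ₚ (s +ₚ scale (- k) b)) n
        ≈⟨ trans (coeff-+ₚ ((k ∷ quot) *ₚ b) (s +ₚ scale (- k) b) n) (+-cong (coeff-*ₚ k quot b n) (coeff-rem n)) ⟩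
          (k * coeff b n + coeff (shift (quot *ₚ b)) n) + (coeff s n + - (k * coeff b n))
        ≈⟨ solve 4 (λ x z y w → (x :+ z) :+ (y :+ w) := (z :+ y) :+ (x :+ w)) refl _ _ _ _ ⟩
          (coeff (shift (quot *ₚ b)) n + coeff s n) + (k * coeff b n + - (k * coeff b n))
        ≈⟨ trans (+-cong refl (-‿inverseʳ _)) (+-identityʳ _) ⟩
          coeff (shift (quot *ₚ b)) n + coeff s n ∎
        where open SetoidReasoning setoid
      a₀∷a≈ : ∀ n → coeff (a₀ ∷ a) n ≈ coeff (((k ∷ quot) *ₚ b) +ₚ (s +ₚ scale (- k) b)) n
      a₀∷a≈ zero    = sym (trans (coeff-sum zero) (+-identityˡ _))
      a₀∷a≈ (suc n) = trans (a≈ n) (sym (trans (coeff-sum (suc n)) (sym (coeff-+ₚ (quot *ₚ b) rem n))))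
      vanish : ∀ n → m ℕ.≤ n → coeff (s +ₚ scale (- k) b) n ≈ 0#
      vanish n m≤n with ℕₚ.m≤n⇒m<n∨m≡n m≤n
      vanish (suc n) _ | inj₁ (s≤s m≤n) = trans (coeff-+ₚ s (scale (- k) b) (suc n))
        (trans (+-cong (rem-vanish n m≤n)
                       (trans (coeff-scale (- k) b (suc n)) (*-cong refl (vanishes (below db) (suc n) (s≤s m≤n)))))
          (trans (+-identityˡ _) (zeroʳ _)))
      vanish n _ | inj₂ ≡.refl = trans (coeff-rem m) (trans (+-cong refl (-‿cong k*top≈)) (-‿inverseʳ _))

  -- Divisibility and the Euclidean algorithm

  record _∣_ (a b : Pol) : Set (c ⊔ ℓ) where
    constructor divides
    field
      quotient : Pol
      equality : (a *ₚ quotient) ≋ b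
  open _∣_ public

  ∣ₚ⇒∣ : ∀ {a b} → a ∣ₚ b → a ∣ b
  ∣ₚ⇒∣ (d , e) = divides d (pointwise e)

  ∣⇒∣ₚ : ∀ {a b} → a ∣ b → a ∣ₚ b
  ∣⇒∣ₚ (divides d (pointwise e)) = d , e

  ∣-refl : ∀ a → a ∣ a
  ∣-refl a = divides oneₚ (≋-trans (*ₚ-comm a oneₚ) (*ₚ-identityˡ a))

  ∣-respʳ : ∀ {a b b'} → b ≋ b' → a ∣ b → a ∣ b'
  ∣-respʳ b≈b' (divides d e) = divides d (≋-trans e b≈b')

  ∣-trans : ∀ {a b d} → a ∣ b → b ∣ d → a ∣ d
  ∣-trans {a} (divides x e) (divides y f) =
    divides (x *ₚ y) (≋-trans (≋-sym (*ₚ-assoc a x y)) (≋-trans (*ₚ-congˡ y e) f))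

  ∣-linear : ∀ {d x y} α β → d ∣ x → d ∣ y → d ∣ ((α *ₚ x) +ₚ (β *ₚ y))
  ∣-linear {d} α β (divides x' ex) (divides y' ey) = divides ((α *ₚ x') +ₚ (β *ₚ y'))
    (≋-trans (solveₚ 5 (λ d α β x' y' → d ⊛ ((α ⊛ x') ⊕ (β ⊛ y')) ⊜ (α ⊛ (d ⊛ x')) ⊕ (β ⊛ (d ⊛ y')))
                       ≋-refl d α β x' y')
             (+ₚ-cong (*ₚ-congʳ α ex) (*ₚ-congʳ β ey)))

  BézoutCombination : Pol → Pol → Pol → Set (c ⊔ ℓ)
  BézoutCombination g a b = Σ Pol λ α → Σ Pol λ β → g ≋ ((α *ₚ a) +ₚ (β *ₚ b))

  BézoutGcd : Pol → Pol → Pol → Set (c ⊔ ℓ)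
  BézoutGcd g a b = g ∣ a × g ∣ b × BézoutCombination g a b

  euclid : ∀ n a b → DegBelow b n → Σ Pol λ g → BézoutGcd g a b
  euclid n a b b<n with ≋[]⊎HasDeg b
  ... | inj₁ (b≈0 , _) = a , ∣-refl a , divides [] (≋-trans (*ₚ-zeroʳ a) (≋-sym b≈0)) ,
                         oneₚ , [] , ≋-sym (≋-trans (+ₚ-identityʳ _) (*ₚ-identityˡ a))
  euclid (suc n) a b b<n | inj₂ (m , db , _) with divMod db a
  ... | quot , rem , a≈ , rem<m
      with euclid n b rem (DegBelow-mono (ℕₚ.<⇒≤pred (HasDeg⇒< db b<n)) rem<m)
  ...   | g , g∣b , g∣rem , α , β , g≈ =
    g , ∣-respʳ (≋-trans (+ₚ-cong {quot *ₚ b} ≋-refl (*ₚ-identityˡ rem)) (≋-sym a≈)) (∣-linear quot oneₚ g∣b g∣rem) ,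
    g∣b , β , (α +ₚ negₚ (β *ₚ quot)) , ≋-sym g≈'
    where
      g≈' : ((β *ₚ a) +ₚ ((α +ₚ negₚ (β *ₚ quot)) *ₚ b)) ≋ g
      g≈' = begin
          (β *ₚ a) +ₚ ((α +ₚ negₚ (β *ₚ quot)) *ₚ b)
        ≈⟨ +ₚ-cong (*ₚ-congʳ β a≈) ≋-refl ⟩
          (β *ₚ ((quot *ₚ b) +ₚ rem)) +ₚ ((α +ₚ negₚ (β *ₚ quot)) *ₚ b)
        ≈⟨ solveₚ 6 (λ β q b r α N → (β ⊛ ((q ⊛ b) ⊕ r)) ⊕ ((α ⊕ N) ⊛ b)
                                   ⊜ ((α ⊛ b) ⊕ (β ⊛ r)) ⊕ (((β ⊛ q) ⊕ N) ⊛ b))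
                  ≋-refl β quot b rem α (negₚ (β *ₚ quot)) ⟩
          ((α *ₚ b) +ₚ (β *ₚ rem)) +ₚ (((β *ₚ quot) +ₚ negₚ (β *ₚ quot)) *ₚ b)
        ≈⟨ +ₚ-cong (≋-sym g≈) (*ₚ-congˡ b (+ₚ-inverseʳ (β *ₚ quot))) ⟩
          g +ₚ ([] *ₚ b)
        ≈⟨ +ₚ-identityʳ g ⟩
          g ∎
        where open SetoidReasoning ≋-setoid
  euclid zero a b b<0 | inj₂ (m , db , _) = ⊥-elim (top≉0 db (vanishes b<0 m z≤n))

  const : Carrier → Pol
  const x = x ∷ []

  coeff-const-*ₚ : ∀ x p k → coeff (const x *ₚ p) k ≈ x * coeff p k
  coeff-const-*ₚ x p k = trans (coeff-*ₚ x [] p k) (trans (+-cong refl (coeff-≈ shift-[] k)) (+-identityʳ _))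

  monic-associate : ∀ {g m} → HasDeg g m → Σ Carrier λ u → Monic (const u *ₚ g) × (const u *ₚ g) ∣ g
  monic-associate {g} {m} dg = u , monic , divides (const (coeff g m)) ug∣g
    where
      u = proj₁ (inverse (coeff g m) (top≉0 dg))
      u*top≈1 : u * coeff g m ≈ 1#
      u*top≈1 = trans (*-comm _ _) (proj₂ (inverse (coeff g m) (top≉0 dg)))
      dug : HasDeg (const u *ₚ g) m
      dug = hasDeg (λ top≈0 → 0≉1 (trans (sym top≈0) (trans (coeff-const-*ₚ u g m) u*top≈1)))
                   (degBelow λ k le → trans (coeff-const-*ₚ u g k)
                                        (trans (*-cong refl (vanishes (below dg) k le)) (zeroʳ u)))
      monic : Monic (const u *ₚ g)
      monic = trans (lead-HasDeg dug) (trans (coeff-const-*ₚ u g m) u*top≈1)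
      ug∣g : ((const u *ₚ g) *ₚ const (coeff g m)) ≋ g
      ug∣g = begin
          (const u *ₚ g) *ₚ const (coeff g m)
        ≈⟨ solveₚ 3 (λ u g t → (u ⊛ g) ⊛ t ⊜ (t ⊛ u) ⊛ g) ≋-refl (const u) g (const (coeff g m)) ⟩
          (const (coeff g m) *ₚ const u) *ₚ g
        ≈⟨ *ₚ-congˡ {const (coeff g m) *ₚ const u} {oneₚ} g (pointwise λ
             { zero → trans (coeff-const-*ₚ (coeff g m) (const u) 0) (trans (*-comm _ _) u*top≈1)
             ; (suc k) → trans (coeff-const-*ₚ (coeff g m) (const u) (suc k)) (zeroʳ _) }) ⟩
          oneₚ *ₚ g
        ≈⟨ *ₚ-identityˡ g ⟩
          g ∎
        where open SetoidReasoning ≋-setoid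

  gcd-Bézout : ∀ a b {m} → HasDeg a m → Σ Pol λ g → IsGCD g a b × BézoutCombination g a b
  gcd-Bézout a b da with euclid (length b) a b (DegBelow-length b)
  ... | g , g∣a , g∣b , α , β , g≈ with ≋[]⊎HasDeg g
  ...   | inj₁ (g≈0 , _) = ⊥-elim (HasDeg⇒≉[] da (≋-trans (≋-sym (equality g∣a)) (*ₚ-zeroˡ (quotient g∣a) g≈0)))
  ...   | inj₂ (_ , dg , _) with monic-associate dg
  ...     | u , monic , ug∣g = const u *ₚ g ,
    (monic , ∣⇒∣ₚ (∣-trans ug∣g g∣a) , ∣⇒∣ₚ (∣-trans ug∣g g∣b) ,
     λ d d∣a d∣b → ∣⇒∣ₚ (∣-respʳ (≋-sym ug≈) (∣-linear (const u *ₚ α) (const u *ₚ β) (∣ₚ⇒∣ {d} d∣a) (∣ₚ⇒∣ {d} d∣b)))) ,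
    (const u *ₚ α) , (const u *ₚ β) , ug≈
    where
      ug≈ : (const u *ₚ g) ≋ (((const u *ₚ α) *ₚ a) +ₚ ((const u *ₚ β) *ₚ b))
      ug≈ = ≋-trans (*ₚ-congʳ (const u) g≈)
        (solveₚ 5 (λ u α a β b → u ⊛ ((α ⊛ a) ⊕ (β ⊛ b)) ⊜ ((u ⊛ α) ⊛ a) ⊕ ((u ⊛ β) ⊛ b)) ≋-refl (const u) α a β b)

  ∣-product-of-Bézout : ∀ {g a b c g₁ g₂} → g ∣ c → g ∣ (a *ₚ b)
    → BézoutCombination g₁ c a → BézoutCombination g₂ c b → g ∣ (g₁ *ₚ g₂)
  ∣-product-of-Bézout {g} {a} {b} {c} {g₁} {g₂} g∣c g∣ab (α₁ , β₁ , g₁≈) (α₂ , β₂ , g₂≈) =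
    ∣-respʳ (≋-sym g₁g₂≈) (∣-linear ((α₁ *ₚ g₂) +ₚ (β₁ *ₚ (α₂ *ₚ a))) (β₁ *ₚ β₂) g∣c g∣ab)
    where
      g₁g₂≈ : (g₁ *ₚ g₂) ≋ ((((α₁ *ₚ g₂) +ₚ (β₁ *ₚ (α₂ *ₚ a))) *ₚ c) +ₚ ((β₁ *ₚ β₂) *ₚ (a *ₚ b)))
      g₁g₂≈ = begin
          g₁ *ₚ g₂
        ≈⟨ *ₚ-congˡ g₂ g₁≈ ⟩
          ((α₁ *ₚ c) +ₚ (β₁ *ₚ a)) *ₚ g₂
        ≈⟨ solveₚ 5 (λ α₁ c β₁ a g₂ → ((α₁ ⊛ c) ⊕ (β₁ ⊛ a)) ⊛ g₂ ⊜ ((α₁ ⊛ g₂) ⊛ c) ⊕ ((β₁ ⊛ a) ⊛ g₂))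
                  ≋-refl α₁ c β₁ a g₂ ⟩
          ((α₁ *ₚ g₂) *ₚ c) +ₚ ((β₁ *ₚ a) *ₚ g₂)
        ≈⟨ +ₚ-cong {(α₁ *ₚ g₂) *ₚ c} ≋-refl (*ₚ-congʳ (β₁ *ₚ a) g₂≈) ⟩
          ((α₁ *ₚ g₂) *ₚ c) +ₚ ((β₁ *ₚ a) *ₚ ((α₂ *ₚ c) +ₚ (β₂ *ₚ b)))
        ≈⟨ solveₚ 8 (λ α₁ g₂ c β₁ a α₂ β₂ b →
                       ((α₁ ⊛ g₂) ⊛ c) ⊕ ((β₁ ⊛ a) ⊛ ((α₂ ⊛ c) ⊕ (β₂ ⊛ b)))
                     ⊜ (((α₁ ⊛ g₂) ⊕ (β₁ ⊛ (α₂ ⊛ a))) ⊛ c) ⊕ ((β₁ ⊛ β₂) ⊛ (a ⊛ b)))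
                  ≋-refl α₁ g₂ c β₁ a α₂ β₂ b ⟩
          (((α₁ *ₚ g₂) +ₚ (β₁ *ₚ (α₂ *ₚ a))) *ₚ c) +ₚ ((β₁ *ₚ β₂) *ₚ (a *ₚ b))
        ∎
        where open SetoidReasoning ≋-setoid

  degree-exchange : ∀ a b c d x y → a ℕ.+ b ≡ c ℕ.+ d → a ℕ.+ x ≡ c ℕ.+ y → d ℕ.≤ y ℕ.+ b
  degree-exchange a b c d x y ab≡cd ax≡cy =
    ≡.subst (d ℕ.≤_) (ℕₚ.+-cancelˡ-≡ (a ℕ.+ c) (x ℕ.+ d) (y ℕ.+ b) ac+xd≡ac+yb) (ℕₚ.m≤n+m d x)
    where
      open ≡.≡-Reasoning
      ac+xd≡ac+yb : (a ℕ.+ c) ℕ.+ (x ℕ.+ d) ≡ (a ℕ.+ c) ℕ.+ (y ℕ.+ b)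
      ac+xd≡ac+yb = begin
        (a ℕ.+ c) ℕ.+ (x ℕ.+ d) ≡⟨ +-interchange a c x d ⟩
        (a ℕ.+ x) ℕ.+ (c ℕ.+ d) ≡⟨ ≡.cong₂ ℕ._+_ ax≡cy (≡.sym ab≡cd) ⟩
        (c ℕ.+ y) ℕ.+ (a ℕ.+ b) ≡⟨ +-interchange c y a b ⟩
        (c ℕ.+ a) ℕ.+ (y ℕ.+ b) ≡⟨ ≡.cong (ℕ._+ (y ℕ.+ b)) (ℕₚ.+-comm c a) ⟩
        (a ℕ.+ c) ℕ.+ (y ℕ.+ b) ∎

  q^-mono-≤ : ∀ {m n} → m ℕ.≤ n → q ^ m ℕ.≤ q ^ n
  q^-mono-≤ = ℕₚ.^-monoʳ-≤ q {{nonZeroIndex (proj₁ (enum-sur 0#))}}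

  cofactor-∣∣ₚ-≤ : ∀ {C g e g₁ e₁ g₂ m} → HasDeg C m → Monic g₁ → Monic g₂
    → (g *ₚ e) ≋ C → (g₁ *ₚ e₁) ≋ C → g ∣ (g₁ *ₚ g₂) → ∣ e₁ ∣ₚ ℕ.≤ ∣ g₂ ∣ₚ ℕ.* ∣ e ∣ₚ
  cofactor-∣∣ₚ-≤ {C} {g} {e} {g₁} {e₁} {g₂} dC monic₁ monic₂ ge≈C g₁e₁≈C (divides x gx≈g₁g₂) = begin
      ∣ e₁ ∣ₚ                   ≡⟨ ∣∣ₚ-HasDeg de₁ ⟩
      q ^ deg-e₁                ≤⟨ q^-mono-≤ (degree-exchange deg-g deg-e deg-g₁ deg-e₁ deg-x deg-g₂ eqC eqg₁g₂) ⟩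
      q ^ (deg-g₂ ℕ.+ deg-e)    ≡⟨ ℕₚ.^-distribˡ-+-* q deg-g₂ deg-e ⟩
      q ^ deg-g₂ ℕ.* q ^ deg-e  ≡⟨ ≡.cong₂ ℕ._*_ (≡.sym (∣∣ₚ-HasDeg dg₂)) (≡.sym (∣∣ₚ-HasDeg de)) ⟩
      ∣ g₂ ∣ₚ ℕ.* ∣ e ∣ₚ        ∎
    where
      open ℕₚ.≤-Reasoning
      deg-g₁ = proj₁ (Monic⇒HasDeg g₁ monic₁)
      dg₁ = proj₂ (Monic⇒HasDeg g₁ monic₁)
      deg-g₂ = proj₁ (Monic⇒HasDeg g₂ monic₂)
      dg₂ = proj₂ (Monic⇒HasDeg g₂ monic₂)
      deg-g = proj₁ (HasDeg-factorʳ e g dC (≋-trans (*ₚ-comm e g) ge≈C))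
      dg = proj₂ (HasDeg-factorʳ e g dC (≋-trans (*ₚ-comm e g) ge≈C))
      deg-e = proj₁ (HasDeg-factorʳ g e dC ge≈C)
      de = proj₂ (HasDeg-factorʳ g e dC ge≈C)
      deg-e₁ = proj₁ (HasDeg-factorʳ g₁ e₁ dC g₁e₁≈C)
      de₁ = proj₂ (HasDeg-factorʳ g₁ e₁ dC g₁e₁≈C)
      deg-x = proj₁ (HasDeg-factorʳ g x (HasDeg-*ₚ dg₁ dg₂) gx≈g₁g₂)
      dx = proj₂ (HasDeg-factorʳ g x (HasDeg-*ₚ dg₁ dg₂) gx≈g₁g₂)
      eqC : deg-g ℕ.+ deg-e ≡ deg-g₁ ℕ.+ deg-e₁
      eqC = HasDeg-unique (HasDeg-resp ge≈C (HasDeg-*ₚ dg de)) (HasDeg-resp g₁e₁≈C (HasDeg-*ₚ dg₁ de₁))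
      eqg₁g₂ : deg-g ℕ.+ deg-x ≡ deg-g₁ ℕ.+ deg-g₂
      eqg₁g₂ = HasDeg-unique (HasDeg-resp gx≈g₁g₂ (HasDeg-*ₚ dg dx)) (HasDeg-*ₚ dg₁ dg₂)

  ≤*∧²<⇒≤² : ∀ H G E → H ℕ.≤ G ℕ.* E → G ℕ.* G ℕ.< H → H ℕ.≤ E ℕ.* E
  ≤*∧²<⇒≤² H G E H≤GE G²<H with H ℕₚ.≤? E ℕ.* E
  ... | yes H≤E² = H≤E²
  ... | no  H≰E² = ⊥-elim (ℕₚ.<⇒≱ (ℕₚ.*-mono-< G²<H (ℕₚ.≰⇒> H≰E²))
                     (≡.subst (H ℕ.* H ℕ.≤_) (*-interchange G E G E) (ℕₚ.*-mono-≤ H≤GE H≤GE)))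

  Separated : ℕ → Pol → Pol → Set (c ⊔ ℓ)
  Separated h a b = (∀ g → IsGCD g a b → ∀ e → (g *ₚ e) ≈ₚ a → q ^ h ℕ.≤ ∣ e ∣ₚ)
                  × (∀ g → IsGCD g a b → ∣ g ∣ₚ ℕ.* ∣ g ∣ₚ ℕ.< q ^ h)

  distinct⇒Separated : ∀ {h a b} → a ≈ₚ b ⊎ Separated h a b → ¬ (b ≈ₚ a) → Separated h a b
  distinct⇒Separated (inj₁ a≈b) b≉a = ⊥-elim (b≉a λ n → sym (a≈b n))
  distinct⇒Separated (inj₂ sep) _   = sep

  IsGCD-comm : ∀ {g a b} → IsGCD g a b → IsGCD g b a
  IsGCD-comm (monic , g∣a , g∣b , greatest) = monic , g∣b , g∣a , λ d d∣b d∣a → greatest d d∣a d∣b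

  cofactor-gcd-product : ∀ h A B C → Monic C → Separated h C A → Separated h C B
    → ∀ g → IsGCD g C (A *ₚ B) → ∀ e → (g *ₚ e) ≈ₚ C → q ^ h ℕ.≤ ∣ e ∣ₚ ℕ.* ∣ e ∣ₚ
  cofactor-gcd-product h A B C monicC (cofactor₁-large , _) (_ , gcd₂-small) g (_ , g∣C , g∣AB , _) e ge≈C
    with Monic⇒HasDeg C monicC
  ... | _ , dC with gcd-Bézout C A dC | gcd-Bézout C B dC
  ...   | g₁ , gcd₁@(monic₁ , (e₁ , g₁e₁≈C) , _) , bézout₁ | g₂ , gcd₂@(monic₂ , _) , bézout₂ =
    ≤*∧²<⇒≤² (q ^ h) ∣ g₂ ∣ₚ ∣ e ∣ₚ
      (ℕₚ.≤-trans (cofactor₁-large g₁ gcd₁ e₁ g₁e₁≈C)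
        (cofactor-∣∣ₚ-≤ {C} {g} {e} {g₁} {e₁} {g₂} dC monic₁ monic₂ (pointwise ge≈C) (pointwise g₁e₁≈C)
          (∣-product-of-Bézout (∣ₚ⇒∣ g∣C) (∣ₚ⇒∣ g∣AB) bézout₁ bézout₂)))
      (gcd₂-small g₂ gcd₂)

open import Data.Nat using (ℕ; _≤_; _<_; _^_; _*_)
open import Data.Fin using (Fin; zero; suc)
open import Data.Product using (_×_; _,_; proj₁)
open import Data.Sum using (_⊎_)
open import Relation.Nullary using (¬_)
open import Relation.Binary.PropositionalEquality using (_≢_)

lemma4p1 : ∀ {c ℓ : Level} (F : FiniteField c ℓ) → let open Poly F in
    (Q : Pol) → Squarefree Q → Monic Q → (h : ℕ) → (R : Fin 5 → Pol)
    → (∀ i → Monic (R i) × R i ∣ₚ Q)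
    → (∀ i → q ^ h ≤ ∣ R i ∣ₚ)
    → (∀ i j k → i ≢ j → j ≢ k → i ≢ k → ¬ (R i ≈ₚ R j × R j ≈ₚ R k))
    → (∀ i j → i ≢ j → R i ≈ₚ R j
         ⊎ ((∀ g → IsGCD g (R i) (R j) → ∀ e → (g *ₚ e) ≈ₚ R i → q ^ h ≤ ∣ e ∣ₚ)
           × (∀ g → IsGCD g (R i) (R j) → ∣ g ∣ₚ * ∣ g ∣ₚ < q ^ h)))
    → ¬ (R zero ≈ₚ R (suc zero)) → ¬ (R (suc zero) ≈ₚ R (suc (suc zero)))
    → ¬ (R zero ≈ₚ R (suc (suc zero)))
    → (∀ g → IsGCD g (R zero) (R (suc zero)) → ∀ e → (g *ₚ e) ≈ₚ R (suc zero)
         → q ^ h ≤ ∣ e ∣ₚ)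
      × (∀ g → IsGCD g (R (suc (suc zero))) (R zero *ₚ R (suc zero))
         → ∀ e → (g *ₚ e) ≈ₚ R (suc (suc zero)) → q ^ h ≤ ∣ e ∣ₚ * ∣ e ∣ₚ)
lemma4p1 F Q _ _ h R monic∣Q _ _ dichotomy R₁≉R₂ R₂≉R₃ R₁≉R₃ =
    (λ g gcd → proj₁ (separated (suc zero) zero (λ ()) R₁≉R₂) g (IsGCD-comm {g} {R zero} {R (suc zero)} gcd))
  , cofactor-gcd-product h (R zero) (R (suc zero)) (R (suc (suc zero))) (proj₁ (monic∣Q (suc (suc zero))))
      (separated (suc (suc zero)) zero (λ ()) R₁≉R₃) (separated (suc (suc zero)) (suc zero) (λ ()) R₂≉R₃)
  where
    open Poly F
    open PolynomialGcd F
    separated : ∀ i j → i ≢ j → ¬ (R j ≈ₚ R i) → Separated h (R i) (R j)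
    separated i j i≢j Rj≉Ri = distinct⇒Separated {h} {R i} {R j} (dichotomy i j i≢j) Rj≉Ri
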